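{- Let $\zeta_3$ be a primitive cube root of unity and $P=[\zeta_3,\zeta_3^2,1]\in\mathbb{P}^2(\overline{\mathbb{Q}})$. Let $\mathcal{C}$ be a projective plane conic defined over $\mathbb{Q}$ with equation $ax^2+by^2+cz^2+dxy+exz+fyz=0$, where $a,b,c,d,e,f\in\mathbb{Q}$. (1) If $\mathcal{C}$ is irreducible over $\mathbb{Q}$ and $P\in\mathcal{C}$, then $P$ is a smooth point of $\mathcal{C}$. (2) The following two conditions are equivalent: (2.1) $\mathcal{C}$ is irreducible over $\mathbb{Q}$, $P$ belongs to $\mathcal{C}$, and the tangent line to $\mathcal{C}$ at $P$ equals the tangent line to $F_5$ at $P$; (2.2) $a=b=c$, $d=e=f$ and $d\neq 2a$.
   Context: $F_5$ denotes the Fermat curve $x^5+y^5+z^5=0$ in $\mathbb{P}^2$; the point $P$ lies on $F_5$. "Irreducible over $\mathbb{Q}$" means the (nonzero) quadratic form defining $\mathcal{C}$ is irreducible in $\mathbb{Q}[x,y,z]$. -}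

module Defs where

open import Data.Rational using (ℚ; 0ℚ; 1ℚ; _+_; _*_; _-_; -_)
open import Data.Nat using (ℕ; zero; suc)
open import Data.Product using (Σ; _×_; _,_; ∃)
open import Data.Sum using (_⊎_)
open import Relation.Binary.PropositionalEquality using (_≡_)
open import Relation.Nullary using (¬_)

-- The field ℚ(ζ₃) = ℚ[ω]/(ω² + ω + 1).  An element  re + im·ω.
-- ω denotes a (fixed) primitive cube root of unity.

record ℚω : Set where
  constructor mkω
  field
    re : ℚ
    im : ℚ
open ℚω public

infixl 6 _⊕_
infixl 7 _⊗_

_⊕_ : ℚω → ℚω → ℚω
mkω p q ⊕ mkω r s = mkω (p + r) (q + s)

-- (p + qω)(r + sω) = pr + (ps + qr)ω + qs ω²,   ω² = -1 - ω
_⊗_ : ℚω → ℚω → ℚω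
mkω p q ⊗ mkω r s = mkω ((p * r) - (q * s)) (((p * s) + (q * r)) - (q * s))

emb : ℚ → ℚω
emb r = mkω r 0ℚ

0ω : ℚω
0ω = emb 0ℚ

1ω : ℚω
1ω = emb 1ℚ

ω : ℚω
ω = mkω 0ℚ 1ℚ

_^ω_ : ℚω → ℕ → ℚω
x ^ω zero = 1ω
x ^ω suc n = x ⊗ (x ^ω n)

Vec3 : Set
Vec3 = ℚω × ℚω × ℚω

scale : ℚω → Vec3 → Vec3
scale l (u , v , w) = (l ⊗ u , l ⊗ v , l ⊗ w)

NonZero3 : Vec3 → Set
NonZero3 (u , v , w) = ¬ (u ≡ 0ω × v ≡ 0ω × w ≡ 0ω)

SameLine : Vec3 → Vec3 → Set
SameLine v w = NonZero3 v × NonZero3 w × Σ ℚω (λ l → ¬ (l ≡ 0ω) × v ≡ scale l w)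

P : Vec3
P = (ω , ω ^ω 2 , 1ω)

record Conic : Set where
  constructor conic
  field
    a b c d e f : ℚ
open Conic public

evalC : Conic → Vec3 → ℚω
evalC (conic a b c d e f) (x , y , z) =
  emb a ⊗ (x ⊗ x) ⊕ emb b ⊗ (y ⊗ y) ⊕ emb c ⊗ (z ⊗ z)
  ⊕ emb d ⊗ (x ⊗ y) ⊕ emb e ⊗ (x ⊗ z) ⊕ emb f ⊗ (y ⊗ z)

gradC : Conic → Vec3 → Vec3
gradC (conic a b c d e f) (x , y , z) =
  ( emb (a + a) ⊗ x ⊕ emb d ⊗ y ⊕ emb e ⊗ z
  , emb d ⊗ x ⊕ emb (b + b) ⊗ y ⊕ emb f ⊗ z
  , emb e ⊗ x ⊕ emb f ⊗ y ⊕ emb (c + c) ⊗ z )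

five : ℚω
five = emb (1ℚ + 1ℚ + 1ℚ + 1ℚ + 1ℚ)

gradF5 : Vec3 → Vec3
gradF5 (x , y , z) = (five ⊗ (x ^ω 4) , five ⊗ (y ^ω 4) , five ⊗ (z ^ω 4))

OnConic : Conic → Vec3 → Set
OnConic C p = evalC C p ≡ 0ω

SmoothAt : Conic → Vec3 → Set
SmoothAt C p = NonZero3 (gradC C p)

SameTangent : Conic → Vec3 → Set
SameTangent C p = SameLine (gradC C p) (gradF5 p)

ZeroForm : Conic → Set
ZeroForm (conic a b c d e f) =
  a ≡ 0ℚ × b ≡ 0ℚ × c ≡ 0ℚ × d ≡ 0ℚ × e ≡ 0ℚ × f ≡ 0ℚ

IsProductOfLinear : Conic → Set
IsProductOfLinear (conic a b c d e f) =
  Σ (ℚ × ℚ × ℚ) λ { (l₁ , l₂ , l₃) → Σ (ℚ × ℚ × ℚ) λ { (m₁ , m₂ , m₃) →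
    a ≡ l₁ * m₁ × b ≡ l₂ * m₂ × c ≡ l₃ * m₃ ×
    d ≡ (l₁ * m₂) + (l₂ * m₁) × e ≡ (l₁ * m₃) + (l₃ * m₁) ×
    f ≡ (l₂ * m₃) + (l₃ * m₂) } }

-- Irreducible in ℚ[x,y,z]: nonzero and not a product of two non-units.
-- For a nonzero homogeneous quadratic form, non-unit factors are
-- homogeneous of degree 1, so this is: not a product of two linear forms.
IrreducibleQ : Conic → Set
IrreducibleQ C = ¬ ZeroForm C × ¬ IsProductOfLinear C

{-# OPTIONS --safe #-}
-- The gradient of C at p is Mp for M = (2a d e; d 2b f; e f 2c), and that of F₅ at P is 5P since
-- ζ₃⁴ = ζ₃. So P is a singular point of C, resp. C and F₅ share the tangent at P, iff P is an
-- eigenvector of M with eigenvalue 0, resp. with a nonzero eigenvalue μ. In coordinates over the basis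
-- 1, ζ₃ of ℚ(ζ₃), MP = μP is a rational linear system whose solutions are exactly a = b = c, d = e = f,
-- μ = 2a − d. For μ = 0 the form is a(x + y + z)², a product of linear forms. For d ≠ 2a the form
-- Q = a(x² + y² + z²) + d(xy + xz + yz) is irreducible: as 2Q = (2a − d)(x² + y² + z²) + d(x + y + z)²,
-- Q has no nonzero rational zero on the plane x + y + z = 0, whereas a rational linear factor l of Q
-- vanishes at the point l × (1, 1, 1) of that plane, so l is a multiple of x + y + z; two such factors
-- would give d = 2a.
module Submission where

open import Defs
open import Data.Empty using (⊥-elim)
open import Data.Fin.Patterns using (0F; 1F; 2F; 3F; 4F; 5F; 6F; 7F)
open import Data.Nat using (ℕ)
open import Data.Product using (Σ; _×_; _,_; proj₁; proj₂)
open import Data.Rational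
  using (ℚ; 0ℚ; 1ℚ; ½; -½; _+_; _*_; _-_; -_; 1/_; _≤_; _≟_; ≢-nonZero; nonNegative; nonPositive)
open import Data.Rational.Properties
  using ( +-0-group; +-identityˡ; +-identityʳ; +-inverseʳ; *-identityˡ; *-zeroˡ; *-zeroʳ; *-assoc; *-inverseˡ
        ; ≤-antisym; ≤-total; +-mono-≤; +-monoʳ-≤; nonNegative⁻¹; nonNeg*nonNeg⇒nonNeg; nonPos*nonPos⇒nonPos )
open import Algebra.Properties.Group +-0-group using (x∙y⁻¹≈ε⇒x≈y; x≈y⇒x∙y⁻¹≈ε)
open import Data.Rational.Solver using (module +-*-Solver)
open import Data.Sum using (_⊎_; inj₁; inj₂; [_,_]′; reduce)
open import Data.Vec using (Vec; []; _∷_)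
open import Data.Vec.Relation.Unary.All using (All; []; _∷_)
open import Function using (_∘_)
open import Function.Bundles using (_⇔_; mk⇔)
open import Relation.Binary.PropositionalEquality
  using (_≡_; _≢_; refl; sym; trans; cong; cong₂; subst₂; module ≡-Reasoning)
open import Relation.Nullary using (¬_; yes; no)

open +-*-Solver
open ≡-Reasoning

p*q≡0⇒p≡0∨q≡0 : ∀ p q → p * q ≡ 0ℚ → p ≡ 0ℚ ⊎ q ≡ 0ℚ
p*q≡0⇒p≡0∨q≡0 p q pq≡0 with p ≟ 0ℚ
... | yes p≡0 = inj₁ p≡0
... | no  p≢0 = inj₂ (begin
  q               ≡⟨ sym (*-identityˡ q) ⟩
  1ℚ * q          ≡⟨ cong (_* q) (sym (*-inverseˡ p)) ⟩
  (1/ p * p) * q  ≡⟨ *-assoc (1/ p) p q ⟩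
  1/ p * (p * q)  ≡⟨ cong (1/ p *_) pq≡0 ⟩
  1/ p * 0ℚ       ≡⟨ *-zeroʳ (1/ p) ⟩
  0ℚ              ∎)
  where instance _ = ≢-nonZero p≢0

p+p+p≡0⇒p≡0 : ∀ {p} → p + p + p ≡ 0ℚ → p ≡ 0ℚ
p+p+p≡0⇒p≡0 {p} 3p≡0
  with p*q≡0⇒p≡0∨q≡0 (1ℚ + 1ℚ + 1ℚ) p
         (trans (solve 1 (λ p → con (1ℚ + 1ℚ + 1ℚ) :* p := p :+ p :+ p) refl p) 3p≡0)
... | inj₁ ()
... | inj₂ p≡0 = p≡0

p*p≡0⇒p≡0 : ∀ {p} → p * p ≡ 0ℚ → p ≡ 0ℚ
p*p≡0⇒p≡0 {p} p²≡0 = reduce (p*q≡0⇒p≡0∨q≡0 p p p²≡0)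

0≤p*p : ∀ p → 0ℚ ≤ p * p
0≤p*p p with ≤-total 0ℚ p
... | inj₁ 0≤p = nonNegative⁻¹ (p * p) {{nonNeg*nonNeg⇒nonNeg p {{nonNegative 0≤p}} p {{nonNegative 0≤p}}}}
... | inj₂ p≤0 = nonNegative⁻¹ (p * p) {{nonPos*nonPos⇒nonPos p {{nonPositive p≤0}} p {{nonPositive p≤0}}}}

p+q≡0⇒p≡0∧q≡0 : ∀ {p q} → 0ℚ ≤ p → 0ℚ ≤ q → p + q ≡ 0ℚ → p ≡ 0ℚ × q ≡ 0ℚ
p+q≡0⇒p≡0∧q≡0 {p} {q} 0≤p 0≤q p+q≡0 = p≡0 , (begin
  q       ≡⟨ sym (+-identityˡ q) ⟩
  0ℚ + q  ≡⟨ cong (_+ q) (sym p≡0) ⟩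
  p + q   ≡⟨ p+q≡0 ⟩
  0ℚ      ∎)
  where
  p≡0 : p ≡ 0ℚ
  p≡0 = ≤-antisym (subst₂ _≤_ (+-identityʳ p) p+q≡0 (+-monoʳ-≤ p 0≤q)) 0≤p

x²+y²+z²≡0⇒x≡y≡z≡0 : ∀ {x y z} → x * x + y * y + z * z ≡ 0ℚ → x ≡ 0ℚ × y ≡ 0ℚ × z ≡ 0ℚ
x²+y²+z²≡0⇒x≡y≡z≡0 {x} {y} {z} sum≡0 =
  let x²+y²≡0 , z²≡0 = p+q≡0⇒p≡0∧q≡0 (+-mono-≤ (0≤p*p x) (0≤p*p y)) (0≤p*p z) sum≡0
      x²≡0 , y²≡0    = p+q≡0⇒p≡0∧q≡0 (0≤p*p x) (0≤p*p y) x²+y²≡0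
  in p*p≡0⇒p≡0 x²≡0 , p*p≡0⇒p≡0 y²≡0 , p*p≡0⇒p≡0 z²≡0

module LinearCombination {n : ℕ} (ρ : Vec ℚ n) where

  Equation : Set
  Equation = Polynomial n × Polynomial n

  Holds : Equation → Set
  Holds (l , r) = ⟦ l ⟧ ρ ≡ ⟦ r ⟧ ρ

  combination : ∀ {m} → Vec ℚ m → Vec Equation m → Polynomial n
  combination []       []             = con 0ℚ
  combination (k ∷ ks) ((l , r) ∷ es) = con k :* (l :- r) :+ combination ks es

  combination≡0 : ∀ {m} (ks : Vec ℚ m) {es} → All Holds es → ⟦ combination ks es ⟧ ρ ≡ 0ℚ
  combination≡0 []       []                           = refl
  combination≡0 (k ∷ ks) {(l , r) ∷ es} (l≡r ∷ holds) = begin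
    k * (⟦ l ⟧ ρ - ⟦ r ⟧ ρ) + ⟦ combination ks es ⟧ ρ
      ≡⟨ cong₂ (λ u v → k * (u - ⟦ r ⟧ ρ) + v) l≡r (combination≡0 ks holds) ⟩
    k * (⟦ r ⟧ ρ - ⟦ r ⟧ ρ) + 0ℚ  ≡⟨ +-identityʳ _ ⟩
    k * (⟦ r ⟧ ρ - ⟦ r ⟧ ρ)       ≡⟨ cong (k *_) (+-inverseʳ (⟦ r ⟧ ρ)) ⟩
    k * 0ℚ                        ≡⟨ *-zeroʳ k ⟩
    0ℚ                            ∎

  -- The last argument is checked by normalisation: lhs − rhs = Σ kᵢ (lᵢ − rᵢ) as polynomials.
  linear-combination : ∀ {m} (es : Vec Equation m) → All Holds es → (ks : Vec ℚ m) (lhs rhs : Polynomial n) →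
                       ⟦ lhs :- rhs ⟧↓ ρ ≡ ⟦ combination ks es ⟧↓ ρ → ⟦ lhs ⟧ ρ ≡ ⟦ rhs ⟧ ρ
  linear-combination es holds ks lhs rhs nf =
    x∙y⁻¹≈ε⇒x≈y _ _ (trans (prove ρ (lhs :- rhs) (combination ks es) nf) (combination≡0 ks holds))

-- Solver polynomials denoting, definitionally, re and im of  mkω p q ⊗ z.  Here z must be a closed
-- term, so that re z and im z are numerals the solver can compute with.
re⊗ im⊗ : ∀ {n} → Polynomial n → Polynomial n → ℚω → Polynomial n
re⊗ p q z = p :* con (re z) :- q :* con (im z)
im⊗ p q z = p :* con (im z) :+ q :* con (re z) :- q :* con (im z)

⊗-assoc : ∀ x y z → x ⊗ (y ⊗ z) ≡ (x ⊗ y) ⊗ z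
⊗-assoc (mkω p q) (mkω r s) (mkω u v) = cong₂ mkω
  (solve 6 (λ p q r s u v →
       p :* (r :* u :- s :* v) :- q :* (r :* v :+ s :* u :- s :* v)
    := (p :* r :- q :* s) :* u :- (p :* s :+ q :* r :- q :* s) :* v) refl p q r s u v)
  (solve 6 (λ p q r s u v →
       p :* (r :* v :+ s :* u :- s :* v) :+ q :* (r :* u :- s :* v) :- q :* (r :* v :+ s :* u :- s :* v)
    := (p :* r :- q :* s) :* v :+ (p :* s :+ q :* r :- q :* s) :* u :- (p :* s :+ q :* r :- q :* s) :* v)
    refl p q r s u v)

⊗-identityʳ : ∀ x → x ⊗ 1ω ≡ x
⊗-identityʳ (mkω p q) = cong₂ mkω
  (solve 2 (λ p q → re⊗ p q 1ω := p) refl p q)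
  (solve 2 (λ p q → im⊗ p q 1ω := q) refl p q)

⊗-zeroˡ : ∀ x → 0ω ⊗ x ≡ 0ω
⊗-zeroˡ (mkω p q) = cong₂ mkω
  (solve 2 (λ p q → con 0ℚ :* p :- con 0ℚ :* q := con 0ℚ) refl p q)
  (solve 2 (λ p q → con 0ℚ :* q :+ con 0ℚ :* p :- con 0ℚ :* q := con 0ℚ) refl p q)

emb[p-q]≡0⇒p≡q : ∀ {p q} → emb (p - q) ≡ 0ω → p ≡ q
emb[p-q]≡0⇒p≡q eq = x∙y⁻¹≈ε⇒x≈y _ _ (cong re eq)

p≡q⇒emb[p-q]≡0 : ∀ {p q} → p ≡ q → emb (p - q) ≡ 0ω
p≡q⇒emb[p-q]≡0 p≡q = cong emb (x≈y⇒x∙y⁻¹≈ε p≡q)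

scale-scale : ∀ l k v → scale l (scale k v) ≡ scale (l ⊗ k) v
scale-scale l k (u , v , w) = cong₂ _,_ (⊗-assoc l k u) (cong₂ _,_ (⊗-assoc l k v) (⊗-assoc l k w))

scale-zero : ∀ v → scale 0ω v ≡ (0ω , 0ω , 0ω)
scale-zero (u , v , w) = cong₂ _,_ (⊗-zeroˡ u) (cong₂ _,_ (⊗-zeroˡ v) (⊗-zeroˡ w))

linear-at-P : ∀ α β γ → emb α ⊗ ω ⊕ emb β ⊗ (ω ^ω 2) ⊕ emb γ ⊗ 1ω ≡ mkω (γ - β) (α - β)
linear-at-P α β γ = cong₂ mkω
  (solve 3 (λ α β γ → re⊗ α (con 0ℚ) ω :+ re⊗ β (con 0ℚ) (ω ^ω 2) :+ re⊗ γ (con 0ℚ) 1ω := γ :- β)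
    refl α β γ)
  (solve 3 (λ α β γ → im⊗ α (con 0ℚ) ω :+ im⊗ β (con 0ℚ) (ω ^ω 2) :+ im⊗ γ (con 0ℚ) 1ω := α :- β)
    refl α β γ)

gradC-P : ∀ a b c d e f → gradC (conic a b c d e f) P
  ≡ (mkω (e - d) (a + a - d) , mkω (f - (b + b)) (d - (b + b)) , mkω (c + c - f) (e - f))
gradC-P a b c d e f =
  cong₂ _,_ (linear-at-P (a + a) d e) (cong₂ _,_ (linear-at-P d (b + b) f) (linear-at-P e f (c + c)))

scale-P : ∀ s t → scale (mkω s t) P ≡ (mkω (- t) (s - t) , mkω (t - s) (- s) , mkω s t)
scale-P s t = cong₂ _,_
  (cong₂ mkω (solve 2 (λ s t → re⊗ s t ω := :- t) refl s t)
             (solve 2 (λ s t → im⊗ s t ω := s :- t) refl s t))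
  (cong₂ _,_
    (cong₂ mkω (solve 2 (λ s t → re⊗ s t (ω ^ω 2) := t :- s) refl s t)
               (solve 2 (λ s t → im⊗ s t (ω ^ω 2) := :- s) refl s t))
    (⊗-identityʳ (mkω s t)))

-- By computation, as ζ₃⁴ = ζ₃ and ζ₃⁸ = ζ₃².
gradF5-P : gradF5 P ≡ scale five P
gradF5-P = refl

NonZero3-gradF5-P : NonZero3 (gradF5 P)
NonZero3-gradF5-P (_ , _ , ())

P∈symmetric : ∀ a d → OnConic (conic a a a d d d) P
P∈symmetric a d = cong₂ mkω
  (solve 2 (λ a d → evalC-at-P re⊗ a d := con 0ℚ) refl a d)
  (solve 2 (λ a d → evalC-at-P im⊗ a d := con 0ℚ) refl a d)
  where
  evalC-at-P : (Polynomial 2 → Polynomial 2 → ℚω → Polynomial 2) → Polynomial 2 → Polynomial 2 → Polynomial 2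
  evalC-at-P component a d =
    component a (con 0ℚ) (ω ⊗ ω) :+ component a (con 0ℚ) (ω ^ω 2 ⊗ ω ^ω 2) :+ component a (con 0ℚ) (1ω ⊗ 1ω)
    :+ component d (con 0ℚ) (ω ⊗ ω ^ω 2) :+ component d (con 0ℚ) (ω ⊗ 1ω) :+ component d (con 0ℚ) (ω ^ω 2 ⊗ 1ω)

eigenvector-equations : ∀ {a b c d e f s t} →
  e - d ≡ - t → a + a - d ≡ s - t → f - (b + b) ≡ t - s → d - (b + b) ≡ - s → c + c - f ≡ s → e - f ≡ t →
  a ≡ b × b ≡ c × d ≡ e × e ≡ f × s ≡ a + a - d × t ≡ 0ℚ
eigenvector-equations {a} {b} {c} {d} {e} {f} {s} {t} h₁ h₂ h₃ h₄ h₅ h₆ =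
    by (-½ ∷ 0ℚ   ∷ ½    ∷ 0ℚ ∷ ½  ∷ 0ℚ ∷ 0ℚ ∷ []) A B refl
  , by (-½ ∷ 0ℚ   ∷ 0ℚ   ∷ -½ ∷ 0ℚ ∷ -½ ∷ 0ℚ ∷ []) B C refl
  , by (1ℚ ∷ - 1ℚ ∷ 0ℚ   ∷ 0ℚ ∷ 0ℚ ∷ 0ℚ ∷ 0ℚ ∷ []) D E refl
  , by (1ℚ ∷ 0ℚ   ∷ 0ℚ   ∷ 0ℚ ∷ 0ℚ ∷ 0ℚ ∷ 1ℚ ∷ []) E F refl
  , by (1ℚ ∷ 0ℚ   ∷ - 1ℚ ∷ 0ℚ ∷ 0ℚ ∷ 0ℚ ∷ 0ℚ ∷ []) S (A :+ A :- D) refl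
  , t≡0
  where
  ρ : Vec ℚ 8
  ρ = a ∷ b ∷ c ∷ d ∷ e ∷ f ∷ s ∷ t ∷ []

  open LinearCombination ρ

  A B C D E F S T : Polynomial 8
  A = var 0F ; B = var 1F ; C = var 2F ; D = var 3F ; E = var 4F ; F = var 5F ; S = var 6F ; T = var 7F

  equations : Vec Equation 6
  equations = (E :- D , :- T) ∷ (A :+ A :- D , S :- T) ∷ (F :- (B :+ B) , T :- S)
            ∷ (D :- (B :+ B) , :- S) ∷ (C :+ C :- F , S) ∷ (E :- F , T) ∷ []

  hold : All Holds equations
  hold = h₁ ∷ h₂ ∷ h₃ ∷ h₄ ∷ h₅ ∷ h₆ ∷ []

  t≡0 : t ≡ 0ℚ
  t≡0 = p+p+p≡0⇒p≡0
    (linear-combination equations hold (1ℚ ∷ 0ℚ ∷ - 1ℚ ∷ 1ℚ ∷ 0ℚ ∷ - 1ℚ ∷ []) (T :+ T :+ T) (con 0ℚ) refl)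

  by : (ks : Vec ℚ 7) (lhs rhs : Polynomial 8) →
       ⟦ lhs :- rhs ⟧↓ ρ ≡ ⟦ combination ks ((T , con 0ℚ) ∷ equations) ⟧↓ ρ → ⟦ lhs ⟧ ρ ≡ ⟦ rhs ⟧ ρ
  by = linear-combination ((T , con 0ℚ) ∷ equations) (t≡0 ∷ hold)

P-eigenvector⇒symmetric : ∀ a b c d e f μ → gradC (conic a b c d e f) P ≡ scale μ P →
                          a ≡ b × b ≡ c × d ≡ e × e ≡ f × μ ≡ emb (a + a - d)
P-eigenvector⇒symmetric a b c d e f (mkω s t) eigen =
  let a≡b , b≡c , d≡e , e≡f , s≡2a-d , t≡0 = eigenvector-equations
        (cong (re ∘ proj₁) coordinates) (cong (im ∘ proj₁) coordinates)
        (cong (re ∘ proj₁ ∘ proj₂) coordinates) (cong (im ∘ proj₁ ∘ proj₂) coordinates)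
        (cong (re ∘ proj₂ ∘ proj₂) coordinates) (cong (im ∘ proj₂ ∘ proj₂) coordinates)
  in a≡b , b≡c , d≡e , e≡f , cong₂ mkω s≡2a-d t≡0
  where
  coordinates : (mkω (e - d) (a + a - d) , mkω (f - (b + b)) (d - (b + b)) , mkω (c + c - f) (e - f))
              ≡ (mkω (- t) (s - t) , mkω (t - s) (- s) , mkω s t)
  coordinates = trans (sym (gradC-P a b c d e f)) (trans eigen (scale-P s t))

symmetric⇒P-eigenvector : ∀ a d → gradC (conic a a a d d d) P ≡ scale (emb (a + a - d)) P
symmetric⇒P-eigenvector a d = begin
  gradC (conic a a a d d d) P
    ≡⟨ gradC-P a a a d d d ⟩
  (mkω (d - d) (a + a - d) , mkω (d - (a + a)) (d - (a + a)) , mkω (a + a - d) (d - d))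
    ≡⟨ cong₂ _,_ (cong₂ mkω (+-inverseʳ d) (sym (+-identityʳ (a + a - d))))
                 (cong₂ _,_ (cong₂ mkω (solve 2 (λ a d → d :- (a :+ a) := con 0ℚ :- (a :+ a :- d)) refl a d)
                                       (solve 2 (λ a d → d :- (a :+ a) := :- (a :+ a :- d)) refl a d))
                            (cong (mkω (a + a - d)) (+-inverseʳ d))) ⟩
  (mkω (- 0ℚ) (a + a - d - 0ℚ) , mkω (0ℚ - (a + a - d)) (- (a + a - d)) , mkω (a + a - d) 0ℚ)
    ≡⟨ sym (scale-P (a + a - d) 0ℚ) ⟩
  scale (emb (a + a - d)) P
    ∎

P-eigenvalue≢0⇒NonZero3 : ∀ C μ → gradC C P ≡ scale μ P → μ ≢ 0ω → NonZero3 (gradC C P)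
P-eigenvalue≢0⇒NonZero3 C μ eigen μ≢0 (_ , _ , z≡0) =
  μ≢0 (trans (sym (⊗-identityʳ μ)) (trans (cong (proj₂ ∘ proj₂) (sym eigen)) z≡0))

NonZero3⇒P-eigenvalue≢0 : ∀ C μ → gradC C P ≡ scale μ P → NonZero3 (gradC C P) → μ ≢ 0ω
NonZero3⇒P-eigenvalue≢0 C μ eigen nonzero μ≡0 =
  nonzero (cong proj₁ gradC≡0 , cong (proj₁ ∘ proj₂) gradC≡0 , cong (proj₂ ∘ proj₂) gradC≡0)
  where
  gradC≡0 : gradC C P ≡ (0ω , 0ω , 0ω)
  gradC≡0 = trans eigen (trans (cong (λ ν → scale ν P) μ≡0) (scale-zero P))

tangent⇒P-eigenvector : ∀ C → SameTangent C P → Σ ℚω λ μ → gradC C P ≡ scale μ P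
tangent⇒P-eigenvector C (_ , _ , l , _ , tangent) =
  l ⊗ five , trans tangent (trans (cong (scale l) gradF5-P) (scale-scale l five P))

P-eigenvector⇒tangent : ∀ C μ → μ ≢ 0ω → gradC C P ≡ scale μ P → SameTangent C P
P-eigenvector⇒tangent C μ μ≢0 eigen =
  P-eigenvalue≢0⇒NonZero3 C μ eigen μ≢0 , NonZero3-gradF5-P , l , l≢0 , (begin
    gradC C P               ≡⟨ eigen ⟩
    scale μ P               ≡⟨ cong (λ ν → scale ν P) (sym l⊗five≡μ) ⟩
    scale (l ⊗ five) P      ≡⟨ sym (scale-scale l five P) ⟩
    scale l (scale five P)  ≡⟨ cong (scale l) (sym gradF5-P) ⟩
    scale l (gradF5 P)      ∎)
  where
  l : ℚω
  l = μ ⊗ emb (1/ (re five))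

  l⊗five≡μ : l ⊗ five ≡ μ
  l⊗five≡μ = trans (sym (⊗-assoc μ _ five)) (⊗-identityʳ μ)

  l≢0 : l ≢ 0ω
  l≢0 l≡0 = μ≢0 (trans (sym l⊗five≡μ) (trans (cong (_⊗ five) l≡0) (⊗-zeroˡ five)))

tangent⇒symmetric : ∀ a b c d e f → SameTangent (conic a b c d e f) P →
                    a ≡ b × b ≡ c × d ≡ e × e ≡ f × d ≢ a + a
tangent⇒symmetric a b c d e f tangent@(gradC≢0 , _) =
  let μ , eigen = tangent⇒P-eigenvector (conic a b c d e f) tangent
      a≡b , b≡c , d≡e , e≡f , μ≡emb[2a-d] = P-eigenvector⇒symmetric a b c d e f μ eigen
  in a≡b , b≡c , d≡e , e≡f , λ d≡2a →
       NonZero3⇒P-eigenvalue≢0 (conic a b c d e f) μ eigen gradC≢0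
         (trans μ≡emb[2a-d] (p≡q⇒emb[p-q]≡0 (sym d≡2a)))

symmetric⇒tangent : ∀ a d → d ≢ a + a → SameTangent (conic a a a d d d) P
symmetric⇒tangent a d d≢2a =
  P-eigenvector⇒tangent (conic a a a d d d) _ (λ μ≡0 → d≢2a (sym (emb[p-q]≡0⇒p≡q μ≡0))) (symmetric⇒P-eigenvector a d)

a[x+y+z]²-isProductOfLinear : ∀ {a b c d e f} → a ≡ b → b ≡ c → a + a ≡ d → d ≡ e → e ≡ f →
                              IsProductOfLinear (conic a b c d e f)
a[x+y+z]²-isProductOfLinear {a} refl refl refl refl refl =
  (1ℚ , 1ℚ , 1ℚ) , (a , a , a) , a≡1a , a≡1a , a≡1a , 2a≡1a+1a , 2a≡1a+1a , 2a≡1a+1a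
  where
  a≡1a : a ≡ 1ℚ * a
  a≡1a = sym (*-identityˡ a)

  2a≡1a+1a : a + a ≡ 1ℚ * a + 1ℚ * a
  2a≡1a+1a = cong₂ _+_ a≡1a a≡1a

singular-at-P⇒isProductOfLinear : ∀ a b c d e f → gradC (conic a b c d e f) P ≡ (0ω , 0ω , 0ω) →
                                  IsProductOfLinear (conic a b c d e f)
singular-at-P⇒isProductOfLinear a b c d e f singular =
  let a≡b , b≡c , d≡e , e≡f , 0≡emb[2a-d] = P-eigenvector⇒symmetric a b c d e f 0ω (trans singular (sym (scale-zero P)))
  in a[x+y+z]²-isProductOfLinear a≡b b≡c (emb[p-q]≡0⇒p≡q (sym 0≡emb[2a-d])) d≡e e≡f

quadraticForm : Conic → ℚ → ℚ → ℚ → ℚ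
quadraticForm (conic a b c d e f) x y z =
  a * (x * x) + b * (y * y) + c * (z * z) + d * (x * y) + e * (x * z) + f * (y * z)

linearForm : ℚ × ℚ × ℚ → ℚ → ℚ → ℚ → ℚ
linearForm (l₁ , l₂ , l₃) x y z = l₁ * x + l₂ * y + l₃ * z

quadraticForm-of-product : ∀ {a b c d e f} (π : IsProductOfLinear (conic a b c d e f)) x y z →
  quadraticForm (conic a b c d e f) x y z ≡ linearForm (proj₁ π) x y z * linearForm (proj₁ (proj₂ π)) x y z
quadraticForm-of-product ((l₁ , l₂ , l₃) , (m₁ , m₂ , m₃) , refl , refl , refl , refl , refl , refl) x y z =
  solve 9 (λ l₁ l₂ l₃ m₁ m₂ m₃ x y z →
       l₁ :* m₁ :* (x :* x) :+ l₂ :* m₂ :* (y :* y) :+ l₃ :* m₃ :* (z :* z)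
       :+ (l₁ :* m₂ :+ l₂ :* m₁) :* (x :* y) :+ (l₁ :* m₃ :+ l₃ :* m₁) :* (x :* z)
       :+ (l₂ :* m₃ :+ l₃ :* m₂) :* (y :* z)
    := (l₁ :* x :+ l₂ :* y :+ l₃ :* z) :* (m₁ :* x :+ m₂ :* y :+ m₃ :* z))
    refl l₁ l₂ l₃ m₁ m₂ m₃ x y z

symmetric-form-decomposition : ∀ a d x y z →
  quadraticForm (conic a a a d d d) x y z + quadraticForm (conic a a a d d d) x y z
    ≡ (a + a - d) * (x * x + y * y + z * z) + d * ((x + y + z) * (x + y + z))
symmetric-form-decomposition = solve 5 (λ a d x y z →
       Q a d x y z :+ Q a d x y z
    := (a :+ a :- d) :* (x :* x :+ y :* y :+ z :* z) :+ d :* ((x :+ y :+ z) :* (x :+ y :+ z))) refl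
  where
  Q : ∀ {n} → Polynomial n → Polynomial n → Polynomial n → Polynomial n → Polynomial n → Polynomial n
  Q a d x y z = a :* (x :* x) :+ a :* (y :* y) :+ a :* (z :* z) :+ d :* (x :* y) :+ d :* (x :* z) :+ d :* (y :* z)

symmetric-form-anisotropic : ∀ a d x y z → d ≢ a + a → x + y + z ≡ 0ℚ →
                             quadraticForm (conic a a a d d d) x y z ≡ 0ℚ → x ≡ 0ℚ × y ≡ 0ℚ × z ≡ 0ℚ
symmetric-form-anisotropic a d x y z d≢2a x+y+z≡0 Q≡0 =
  [ (λ 2a-d≡0 → ⊥-elim (d≢2a (sym (x∙y⁻¹≈ε⇒x≈y (a + a) d 2a-d≡0)))) , x²+y²+z²≡0⇒x≡y≡z≡0 ]′
    (p*q≡0⇒p≡0∨q≡0 (a + a - d) (x * x + y * y + z * z) (begin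
      [2a-d]|v|²                                    ≡⟨ sym (+-identityʳ [2a-d]|v|²) ⟩
      [2a-d]|v|² + 0ℚ                               ≡⟨ cong ([2a-d]|v|² +_) (sym (*-zeroʳ d)) ⟩
      [2a-d]|v|² + d * (0ℚ * 0ℚ)                    ≡⟨ cong (λ s → [2a-d]|v|² + d * (s * s)) (sym x+y+z≡0) ⟩
      [2a-d]|v|² + d * ((x + y + z) * (x + y + z))  ≡⟨ sym (symmetric-form-decomposition a d x y z) ⟩
      Q + Q                                         ≡⟨ cong₂ _+_ Q≡0 Q≡0 ⟩
      0ℚ                                            ∎))
  where
  Q [2a-d]|v|² : ℚ
  Q = quadraticForm (conic a a a d d d) x y z
  [2a-d]|v|² = (a + a - d) * (x * x + y * y + z * z)

-- Test at l × (1, 1, 1), which lies on the line l = 0 and on the plane x + y + z = 0.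
symmetric-form-vanishing-on-line⇒diagonal : ∀ a d l₁ l₂ l₃ → d ≢ a + a →
  (∀ x y z → linearForm (l₁ , l₂ , l₃) x y z ≡ 0ℚ → quadraticForm (conic a a a d d d) x y z ≡ 0ℚ) →
  l₁ ≡ l₂ × l₂ ≡ l₃
symmetric-form-vanishing-on-line⇒diagonal a d l₁ l₂ l₃ d≢2a vanishes =
  let l₂-l₃≡0 , _ , l₁-l₂≡0 = symmetric-form-anisotropic a d (l₂ - l₃) (l₃ - l₁) (l₁ - l₂) d≢2a
        (solve 3 (λ l₁ l₂ l₃ → l₂ :- l₃ :+ (l₃ :- l₁) :+ (l₁ :- l₂) := con 0ℚ) refl l₁ l₂ l₃)
        (vanishes _ _ _
          (solve 3 (λ l₁ l₂ l₃ → l₁ :* (l₂ :- l₃) :+ l₂ :* (l₃ :- l₁) :+ l₃ :* (l₁ :- l₂) := con 0ℚ) refl l₁ l₂ l₃))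
  in x∙y⁻¹≈ε⇒x≈y l₁ l₂ l₁-l₂≡0 , x∙y⁻¹≈ε⇒x≈y l₂ l₃ l₂-l₃≡0

symmetric-irreducible : ∀ a d → d ≢ a + a → IrreducibleQ (conic a a a d d d)
symmetric-irreducible a d d≢2a = nonzero , not-product
  where
  nonzero : ¬ ZeroForm (conic a a a d d d)
  nonzero (a≡0 , _ , _ , d≡0 , _) = d≢2a (trans d≡0 (sym (cong₂ _+_ a≡0 a≡0)))

  not-product : ¬ IsProductOfLinear (conic a a a d d d)
  not-product π@((l₁ , l₂ , l₃) , (m₁ , m₂ , m₃) , a≡l₁m₁ , _ , _ , d≡l₁m₂+l₂m₁ , _) = d≢2a (begin
    d                  ≡⟨ d≡l₁m₂+l₂m₁ ⟩
    l₁ * m₂ + l₂ * m₁  ≡⟨ cong₂ (λ u v → l₁ * u + v * m₁) (sym m₁≡m₂) (sym l₁≡l₂) ⟩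
    l₁ * m₁ + l₁ * m₁  ≡⟨ cong₂ _+_ (sym a≡l₁m₁) (sym a≡l₁m₁) ⟩
    a + a              ∎)
    where
    L M : ℚ → ℚ → ℚ → ℚ
    L = linearForm (l₁ , l₂ , l₃)
    M = linearForm (m₁ , m₂ , m₃)

    l₁≡l₂ : l₁ ≡ l₂
    l₁≡l₂ = proj₁ (symmetric-form-vanishing-on-line⇒diagonal a d l₁ l₂ l₃ d≢2a λ x y z L≡0 → begin
      quadraticForm (conic a a a d d d) x y z  ≡⟨ quadraticForm-of-product π x y z ⟩
      L x y z * M x y z                        ≡⟨ cong (_* M x y z) L≡0 ⟩
      0ℚ * M x y z                             ≡⟨ *-zeroˡ (M x y z) ⟩
      0ℚ                                       ∎)

    m₁≡m₂ : m₁ ≡ m₂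
    m₁≡m₂ = proj₁ (symmetric-form-vanishing-on-line⇒diagonal a d m₁ m₂ m₃ d≢2a λ x y z M≡0 → begin
      quadraticForm (conic a a a d d d) x y z  ≡⟨ quadraticForm-of-product π x y z ⟩
      L x y z * M x y z                        ≡⟨ cong (L x y z *_) M≡0 ⟩
      L x y z * 0ℚ                             ≡⟨ *-zeroʳ (L x y z) ⟩
      0ℚ                                       ∎)

symmetric⇒irreducible-tangent : ∀ a b c d e f → a ≡ b × b ≡ c × d ≡ e × e ≡ f × d ≢ a + a →
  IrreducibleQ (conic a b c d e f) × OnConic (conic a b c d e f) P × SameTangent (conic a b c d e f) P
symmetric⇒irreducible-tangent a _ _ d _ _ (refl , refl , refl , refl , d≢2a) =
  symmetric-irreducible a d d≢2a , P∈symmetric a d , symmetric⇒tangent a d d≢2a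

proposition1 : (a b c d e f : ℚ) →
    ((IrreducibleQ (conic a b c d e f) → OnConic (conic a b c d e f) P → SmoothAt (conic a b c d e f) P)
    × ((IrreducibleQ (conic a b c d e f) × OnConic (conic a b c d e f) P × SameTangent (conic a b c d e f) P)
        ⇔ (a ≡ b × b ≡ c × d ≡ e × e ≡ f × d ≢ a + a)))
proposition1 a b c d e f =
    (λ (_ , not-product) _ (g₁ , g₂ , g₃) →
       not-product (singular-at-P⇒isProductOfLinear a b c d e f (cong₂ _,_ g₁ (cong₂ _,_ g₂ g₃))))
  , mk⇔ (λ (_ , _ , tangent) → tangent⇒symmetric a b c d e f tangent)
        (symmetric⇒irreducible-tangent a b c d e f)
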